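{- The category $\mathsf{Bms}$ is not complete. In particular, if $u\colon\{a,b\}\to\mathbb Z_{>0}$ is given by $u(a)=1$, $u(b)=2$ (with $\{a,b\}$ discrete), then the boolean multispace $(\{a,b\},u)$ has no countable power (product of countably many copies of itself) in $\mathsf{Bms}$.
   Context: A boolean space is a totally disconnected compact Hausdorff space. A boolean multispace is a pair $(X,u)$ with $X$ a boolean space and $u\colon X\to\mathbb Z_{>0}$ continuous ($\mathbb Z_{>0}$ discrete). $\mathsf{Bms}$ is the category of boolean multispaces whose morphisms $(X,u_X)\to(Y,u_Y)$ are continuous maps $\gamma$ with $u_Y(\gamma(x))$ dividing $u_X(x)$ for all $x\in X$. -}

module Defs where

open import Level using (Level; Lift; lift; lower) renaming (suc to lsuc)
open import Data.Nat using (ℕ; _<_)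
open import Data.Nat.Divisibility using (_∣_)
open import Data.Bool using (Bool; true; false)
open import Data.Unit using (⊤; tt)
open import Data.Empty using (⊥; ⊥-elim)
open import Data.Product using (Σ; _×_; _,_; proj₁; proj₂)
open import Data.Sum using (_⊎_; inj₁; inj₂)
open import Data.List using (List; []; _∷_)
open import Data.List.Membership.Propositional using (_∈_)
open import Data.List.Relation.Unary.Any using (here; there)
open import Relation.Unary using (Pred; _⊆_; _≐_; _∩_)
open import Relation.Binary.PropositionalEquality using (_≡_; _≢_; refl; cong; sym)
open import Relation.Nullary using (¬_; yes; no)
open import Function using (_∘_)

record Topology {ℓ : Level} (X : Set ℓ) : Set (lsuc ℓ) where
  field
    Open      : Pred X ℓ → Set ℓ
    open-resp : ∀ {U V : Pred X ℓ} → U ≐ V → Open U → Open V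
    open-univ : Open (λ _ → Lift ℓ ⊤)
    open-∩    : ∀ {U V : Pred X ℓ} → Open U → Open V → Open (U ∩ V)
    open-⋃    : ∀ {I : Set ℓ} (U : I → Pred X ℓ) → (∀ i → Open (U i)) →
                Open (λ x → Σ I λ i → U i x)
open Topology public

module _ {ℓ : Level} {X : Set ℓ} (T : Topology X) where

  Compact : Set (lsuc ℓ)
  Compact = ∀ {I : Set ℓ} (U : I → Pred X ℓ) → (∀ i → Open T (U i)) →
            (∀ x → Σ I λ i → U i x) →
            Σ (List I) λ is → ∀ x → Σ I λ i → (i ∈ is) × U i x

  Hausdorff : Set (lsuc ℓ)
  Hausdorff = ∀ (x y : X) → x ≢ y →
              Σ (Pred X ℓ) λ U → Σ (Pred X ℓ) λ V →
              Open T U × Open T V × U x × V y × (∀ z → U z → V z → ⊥)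

  Connected : Pred X ℓ → Set (lsuc ℓ)
  Connected S = ∀ (U V : Pred X ℓ) → Open T U → Open T V →
                (∀ x → S x → U x ⊎ V x) →
                (∀ x → S x → U x → V x → ⊥) →
                (S ⊆ U) ⊎ (S ⊆ V)

  TotallyDisconnected : Set (lsuc ℓ)
  TotallyDisconnected = ∀ (S : Pred X ℓ) → Connected S →
                        ∀ x y → S x → S y → x ≡ y

module _ {ℓ : Level} {X Y : Set ℓ} where
  Continuous : Topology X → Topology Y → (X → Y) → Set (lsuc ℓ)
  Continuous TX TY f = ∀ (U : Pred Y ℓ) → Open TY U → Open TX (U ∘ f)

record BMS (ℓ : Level) : Set (lsuc ℓ) where
  field
    Carrier  : Set ℓ
    top      : Topology Carrier
    compact  : Compact top
    hausdorff : Hausdorff top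
    totDisc  : TotallyDisconnected top
    -- multiplicity u : X → ℤ_{>0}, continuous for the discrete topology
    mult     : Carrier → ℕ
    mult-pos : ∀ x → 0 < mult x
    mult-cont : ∀ (S : Pred ℕ ℓ) → Open top (λ x → S (mult x))
open BMS public

record Hom {ℓ : Level} (X Y : BMS ℓ) : Set (lsuc ℓ) where
  field
    fun  : Carrier X → Carrier Y
    cont : Continuous (top X) (top Y) fun
    div  : ∀ x → mult Y (fun x) ∣ mult X x
open Hom public

_≈ₕ_ : ∀ {ℓ} {X Y : BMS ℓ} → Hom X Y → Hom X Y → Set ℓ
f ≈ₕ g = ∀ x → fun f x ≡ fun g x

record CountablePower {ℓ : Level} (A : BMS ℓ) : Set (lsuc (lsuc ℓ)) where
  field
    P  : BMS ℓ
    π  : ℕ → Hom P A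
    universal : ∀ (Y : BMS ℓ) (f : ℕ → Hom Y A) →
                Σ (Hom Y P) λ h →
                  (∀ n x → fun (π n) (fun h x) ≡ fun (f n) x) ×
                  (∀ (h' : Hom Y P) →
                     (∀ n x → fun (π n) (fun h' x) ≡ fun (f n) x) → h' ≈ₕ h)

-- The discrete two-point multispace ({a,b}, u) with u(a) = 1, u(b) = 2
-- (a = false, b = true)

module TwoPoint (ℓ : Level) where
  X : Set ℓ
  X = Lift ℓ Bool

  discrete : Topology X
  discrete = record
    { Open = λ _ → Lift ℓ ⊤
    ; open-resp = λ _ _ → lift tt
    ; open-univ = lift tt
    ; open-∩ = λ _ _ → lift tt
    ; open-⋃ = λ _ _ → lift tt }

  u : X → ℕ
  u (lift false) = 1
  u (lift true)  = 2

  private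
    compact′ : Compact discrete
    compact′ U _ cov =
      (proj₁ (cov (lift false)) ∷ proj₁ (cov (lift true)) ∷ []) , pick
      where
      pick : ∀ x → Σ _ λ i → (i ∈ _) × U i x
      pick (lift false) = proj₁ (cov (lift false)) , here refl , proj₂ (cov (lift false))
      pick (lift true)  = proj₁ (cov (lift true)) , there (here refl) , proj₂ (cov (lift true))

    eqDec : (x y : X) → (x ≡ y) ⊎ (x ≢ y)
    eqDec (lift false) (lift false) = inj₁ refl
    eqDec (lift false) (lift true)  = inj₂ λ ()
    eqDec (lift true)  (lift false) = inj₂ λ ()
    eqDec (lift true)  (lift true)  = inj₁ refl

    hausdorff′ : Hausdorff discrete
    hausdorff′ x y x≢y = (λ z → z ≡ x) , (λ z → z ≡ y) , lift tt , lift tt ,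
                         refl , refl , λ { z refl refl → x≢y refl }

    totDisc′ : TotallyDisconnected discrete
    totDisc′ S conn x y Sx Sy with eqDec x y
    ... | inj₁ eq = eq
    ... | inj₂ neq with conn (λ z → z ≡ x) (λ z → z ≢ x) (lift tt) (lift tt)
                         (λ z _ → split z) (λ z _ p q → q p)
      where
      split : ∀ z → (z ≡ x) ⊎ (z ≢ x)
      split z = eqDec z x
    ... | inj₁ S⊆U = sym (S⊆U Sy)
    ... | inj₂ S⊆V = ⊥-elim (S⊆V Sx refl)

    pos : ∀ x → 0 < u x
    pos (lift false) = Data.Nat.s≤s Data.Nat.z≤n
    pos (lift true)  = Data.Nat.s≤s Data.Nat.z≤n

  ab : BMS ℓ
  ab = record
    { Carrier = X
    ; top = discrete
    ; compact = compact′
    ; hausdorff = hausdorff′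
    ; totDisc = totDisc′
    ; mult = u
    ; mult-pos = pos
    ; mult-cont = λ _ → lift tt }

-- Let A have points a, b with u(b) ∤ u(a), and let ℕ∞ be the one-point compactification of ℕ.
-- The maps δₙ : ℕ∞ → A sending n to b and everything else to a are continuous, so a
-- countable power P would give h : ℕ∞ → P with coordinates (δₙ).  The point h(∞) has all
-- coordinates a, and comparing it (via the uniqueness of factorisations out of one-point
-- spaces) with the point obtained from the constant family a shows u(h ∞) ∣ u(a).  Since
-- u ∘ h is continuous into a discrete space, u(h k) = u(h ∞) for large k; but the k-th
-- coordinate of h k is b, so u(b) ∣ u(h k) ∣ u(a), a contradiction.  For ({a,b}, u) the
-- points b, a with u(b) = 2 ∤ 1 = u(a) do this.
module Submission where

open import Defs
open import Level using (Level; Lift; lift; lower)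
open import Data.Nat using (ℕ; suc; _≤_; _<_; _⊔_; s≤s; z≤n; _*_; _≟_; _<?_)
open import Data.Nat.Properties using (≤-trans; ≤-refl; m≤m⊔n; m≤n⊔m; <-irrefl; ≮⇒≥)
open import Data.Nat.Divisibility using (_∣_; ∣-refl; ∣-trans; m∣m*n; n∣m*n; ∣⇒≤)
open import Data.Bool using (true; false)
open import Data.Unit using (⊤; tt)
open import Data.Empty using (⊥; ⊥-elim)
open import Data.Product using (Σ; _×_; _,_; proj₁; proj₂)
open import Data.Sum using (_⊎_; inj₁; inj₂)
open import Data.List using ([]; _∷_; applyUpTo)
open import Data.List.Membership.Propositional using (_∈_)
open import Data.List.Membership.Propositional.Properties using (∈-applyUpTo⁺)
open import Data.List.Relation.Unary.Any using (here; there)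
open import Relation.Unary using (Pred; Decidable; ∁)
open import Relation.Binary.Definitions using (DecidableEquality)
open import Relation.Binary.PropositionalEquality using (_≡_; _≢_; refl; sym; trans; subst)
open import Relation.Nullary using (¬_; yes; no; ¬?)
open import Function using (_∘_)

*-pos : ∀ {m n} → 0 < m → 0 < n → 0 < m * n
*-pos {suc m} {suc n} _ _ = s≤s z≤n

module _ {ℓ : Level} {X : Set ℓ} (T : Topology X) where

  SeparatedByClopens : Set (Level.suc ℓ)
  SeparatedByClopens = ∀ x y → x ≢ y →
    Σ (Pred X ℓ) λ U → Open T U × Open T (∁ U) × Decidable U × U x × ¬ U y

  hausdorff-fromClopens : SeparatedByClopens → Hausdorff T
  hausdorff-fromClopens sep x y x≢y with sep x y x≢y
  ... | U , oU , o∁U , _ , Ux , ¬Uy = U , ∁ U , oU , o∁U , Ux , ¬Uy , λ _ Uz ∁Uz → ∁Uz Uz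

  totallyDisconnected-fromClopens :
    DecidableEquality X → SeparatedByClopens → TotallyDisconnected T
  totallyDisconnected-fromClopens _≟ₓ_ sep S conn x y Sx Sy with x ≟ₓ y
  ... | yes x≡y = x≡y
  ... | no x≢y with sep x y x≢y
  ...   | U , oU , o∁U , U? , Ux , ¬Uy with conn U (∁ U) oU o∁U (λ z _ → cover z) (λ _ _ Uz ∁Uz → ∁Uz Uz)
    where
    cover : ∀ z → U z ⊎ ∁ U z
    cover z with U? z
    ... | yes Uz = inj₁ Uz
    ... | no ¬Uz = inj₂ ¬Uz
  ...     | inj₁ S⊆U = ⊥-elim (¬Uy (S⊆U Sy))
  ...     | inj₂ S⊆∁U = ⊥-elim (S⊆∁U Sx Ux)

module Spaces (ℓ : Level) where

  discreteTopology : (X : Set ℓ) → Topology X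
  discreteTopology X = record
    { Open = λ _ → Lift ℓ ⊤
    ; open-resp = λ _ _ → lift tt
    ; open-univ = lift tt
    ; open-∩ = λ _ _ → lift tt
    ; open-⋃ = λ _ _ → lift tt }

  point : (m : ℕ) → 0 < m → BMS ℓ
  point m m>0 = record
    { Carrier = Lift ℓ ⊤
    ; top = discreteTopology (Lift ℓ ⊤)
    ; compact = λ U _ cover → (proj₁ (cover (lift tt)) ∷ []) ,
                λ _ → proj₁ (cover (lift tt)) , here refl , proj₂ (cover (lift tt))
    ; hausdorff = hausdorff-fromClopens _ separated
    ; totDisc = totallyDisconnected-fromClopens _ (λ _ _ → yes refl) separated
    ; mult = λ _ → m
    ; mult-pos = λ _ → m>0
    ; mult-cont = λ _ → lift tt }
    where
    separated : SeparatedByClopens (discreteTopology (Lift ℓ ⊤))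
    separated _ _ x≢y = ⊥-elim (x≢y refl)

  constHom : ∀ {m m>0} (Z : BMS ℓ) (z : Carrier Z) → mult Z z ∣ m → Hom (point m m>0) Z
  constHom Z z u∣m = record { fun = λ _ → z ; cont = λ _ _ → lift tt ; div = λ _ → u∣m }

  data ℕ∞ : Set ℓ where
    fin : ℕ → ℕ∞
    ∞   : ℕ∞

  fin-injective : ∀ {j k} → fin j ≡ fin k → j ≡ k
  fin-injective refl = refl

  _≟∞_ : DecidableEquality ℕ∞
  fin j ≟∞ fin k with j ≟ k
  ... | yes refl = yes refl
  ... | no j≢k = no (j≢k ∘ fin-injective)
  fin j ≟∞ ∞ = no λ ()
  ∞ ≟∞ fin k = no λ ()
  ∞ ≟∞ ∞ = yes refl

  Eventually : Pred ℕ ℓ → Set ℓ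
  Eventually V = Σ ℕ λ k → ∀ m → k ≤ m → V m

  OpenNeighbourhoodOf∞ : Pred ℕ∞ ℓ → Set ℓ
  OpenNeighbourhoodOf∞ U = U ∞ → Eventually (U ∘ fin)

  ℕ∞-topology : Topology ℕ∞
  ℕ∞-topology = record
    { Open = OpenNeighbourhoodOf∞
    ; open-resp = λ { (U⊆V , V⊆U) oU V∞ → let k , ev = oU (V⊆U V∞) in k , λ m k≤m → U⊆V (ev m k≤m) }
    ; open-univ = λ _ → 0 , λ _ _ → lift tt
    ; open-∩ = λ { oU oV (U∞ , V∞) →
        let k , evU = oU U∞ ; l , evV = oV V∞ in
        k ⊔ l , λ m k⊔l≤m → evU m (≤-trans (m≤m⊔n k l) k⊔l≤m) , evV m (≤-trans (m≤n⊔m k l) k⊔l≤m) }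
    ; open-⋃ = λ { U oU (i , Ui∞) → let k , ev = oU i Ui∞ in k , λ m k≤m → i , ev m k≤m } }

  open-avoiding-∞ : ∀ (U : Pred ℕ∞ ℓ) → ¬ U ∞ → OpenNeighbourhoodOf∞ U
  open-avoiding-∞ _ ¬U∞ U∞ = ⊥-elim (¬U∞ U∞)

  open-singleton : ∀ k → OpenNeighbourhoodOf∞ (_≡ fin k)
  open-singleton k = open-avoiding-∞ (_≡ fin k) (λ ())

  open-cosingleton : ∀ k → OpenNeighbourhoodOf∞ (_≢ fin k)
  open-cosingleton k _ = suc k , λ { m k<m refl → <-irrefl refl k<m }

  ℕ∞-compact : Compact ℕ∞-topology
  ℕ∞-compact {I} U oU cover = i∞ ∷ applyUpTo (λ m → proj₁ (cover (fin m))) k , pick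
    where
    i∞ : I
    i∞ = proj₁ (cover ∞)
    k : ℕ
    k = proj₁ (oU i∞ (proj₂ (cover ∞)))
    pick : ∀ x → Σ I λ i → (i ∈ i∞ ∷ applyUpTo (λ m → proj₁ (cover (fin m))) k) × U i x
    pick ∞ = i∞ , here refl , proj₂ (cover ∞)
    pick (fin m) with m <? k
    ... | yes m<k = proj₁ (cover (fin m)) , there (∈-applyUpTo⁺ _ m<k) , proj₂ (cover (fin m))
    ... | no m≮k = i∞ , here refl , proj₂ (oU i∞ (proj₂ (cover ∞))) m (≮⇒≥ m≮k)

  ℕ∞-separatedByClopens : SeparatedByClopens ℕ∞-topology
  ℕ∞-separatedByClopens (fin k) y fin≢y =
    (_≡ fin k) , open-singleton k , open-cosingleton k , (_≟∞ fin k) , refl , fin≢y ∘ sym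
  ℕ∞-separatedByClopens ∞ (fin k) _ =
    (_≢ fin k) , open-cosingleton k , open-avoiding-∞ (∁ (_≢ fin k)) (λ ¬∞≢fin → ¬∞≢fin λ ()) ,
    (λ z → ¬? (z ≟∞ fin k)) , (λ ()) , (λ ¬fin≡fin → ¬fin≡fin refl)
  ℕ∞-separatedByClopens ∞ ∞ ∞≢∞ = ⊥-elim (∞≢∞ refl)

  ℕ∞-space : (m : ℕ) → 0 < m → BMS ℓ
  ℕ∞-space m m>0 = record
    { Carrier = ℕ∞
    ; top = ℕ∞-topology
    ; compact = ℕ∞-compact
    ; hausdorff = hausdorff-fromClopens ℕ∞-topology ℕ∞-separatedByClopens
    ; totDisc = totallyDisconnected-fromClopens ℕ∞-topology _≟∞_ ℕ∞-separatedByClopens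
    ; mult = λ _ → m
    ; mult-pos = λ _ → m>0
    ; mult-cont = λ _ Sm → 0 , λ _ _ → Sm }

  mult-eventually-constant : ∀ {m m>0} {Z : BMS ℓ} (h : Hom (ℕ∞-space m m>0) Z) →
    Eventually (λ j → Lift ℓ (mult Z (fun h (fin j)) ≡ mult Z (fun h ∞)))
  mult-eventually-constant {Z = Z} h =
    cont h (λ z → Lift ℓ (mult Z z ≡ mult Z (fun h ∞)))
           (mult-cont Z (λ n → Lift ℓ (n ≡ mult Z (fun h ∞))))
           (lift refl)

module _ {ℓ : Level} {A : BMS ℓ} (power : CountablePower A) where
  open CountablePower power
  open Spaces ℓ

  Factors : ∀ {Y : BMS ℓ} → (ℕ → Hom Y A) → Hom Y P → Set ℓ
  Factors f h = ∀ n y → fun (π n) (fun h y) ≡ fun (f n) y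

  factorisation-unique : ∀ {Y : BMS ℓ} (f : ℕ → Hom Y A) {h h′ : Hom Y P} →
    Factors f h → Factors f h′ → h ≈ₕ h′
  factorisation-unique {Y} f {h} {h′} h-factors h′-factors y =
    trans (unique h h-factors y) (sym (unique h′ h′-factors y))
    where unique = proj₂ (proj₂ (universal Y f))

  -- p and the point q induced by the constant family a on a point of multiplicity u(a)
  -- both factor the constant family a out of a point of multiplicity u(p), so p ≡ q.
  mult-∣-of-constant-coordinates : ∀ (a : Carrier A) (p : Carrier P) →
    (∀ n → fun (π n) p ≡ a) → mult P p ∣ mult A a
  mult-∣-of-constant-coordinates a p p-coords =
    subst (λ z → mult P z ∣ mult A a) (sym p≡q) (div q-hom (lift tt))
    where
    constant-a : ℕ → Hom (point (mult A a) (mult-pos A a)) A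
    constant-a _ = constHom A a ∣-refl
    q-hom : Hom (point (mult A a) (mult-pos A a)) P
    q-hom = proj₁ (universal _ constant-a)
    q-factors : Factors constant-a q-hom
    q-factors = proj₁ (proj₂ (universal _ constant-a))
    q : Carrier P
    q = fun q-hom (lift tt)
    a∣p : mult A a ∣ mult P p
    a∣p = subst (λ x → mult A x ∣ mult P p) (p-coords 0) (div (π 0) p)
    select : (z : Carrier P) → mult P z ∣ mult P p → Hom (point (mult P p) (mult-pos P p)) P
    select = constHom P
    p≡q : p ≡ q
    p≡q = factorisation-unique (λ _ → constHom A a a∣p)
            {select p ∣-refl} {select q (∣-trans (div q-hom (lift tt)) a∣p)}
            (λ n _ → p-coords n) (λ n _ → q-factors n (lift tt))
            (lift tt)

module _ {ℓ : Level} (A : BMS ℓ) (a b : Carrier A) where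
  open Spaces ℓ

  indicator : ℕ → ℕ∞ → Carrier A
  indicator n (fin m) with m ≟ n
  ... | yes _ = b
  ... | no _ = a
  indicator n ∞ = a

  indicator-at : ∀ n → indicator n (fin n) ≡ b
  indicator-at n with n ≟ n
  ... | yes _ = refl
  ... | no n≢n = ⊥-elim (n≢n refl)

  indicator-beyond : ∀ n m → n < m → indicator n (fin m) ≡ a
  indicator-beyond n m n<m with m ≟ n
  ... | yes refl = ⊥-elim (<-irrefl refl n<m)
  ... | no _ = refl

  ℕ∞-ab : BMS ℓ
  ℕ∞-ab = ℕ∞-space (mult A a * mult A b) (*-pos (mult-pos A a) (mult-pos A b))

  indicator-mult-∣ : ∀ n y → mult A (indicator n y) ∣ mult A a * mult A b
  indicator-mult-∣ n ∞ = m∣m*n (mult A b)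
  indicator-mult-∣ n (fin m) with m ≟ n
  ... | yes _ = n∣m*n (mult A a)
  ... | no _ = m∣m*n (mult A b)

  indicatorHom : ℕ → Hom ℕ∞-ab A
  indicatorHom n = record
    { fun = indicator n
    ; cont = λ U _ Ua → suc n , λ m n<m → subst U (sym (indicator-beyond n m n<m)) Ua
    ; div = indicator-mult-∣ n }

  nonDividing⇒¬CountablePower : ¬ (mult A b ∣ mult A a) → ¬ CountablePower A
  nonDividing⇒¬CountablePower b∤a power =
    b∤a (∣-trans b∣hk (subst (_∣ mult A a) (sym hk≡h∞) h∞∣a))
    where
    open CountablePower power
    h : Hom ℕ∞-ab P
    h = proj₁ (universal ℕ∞-ab indicatorHom)
    h-factors : Factors power indicatorHom h
    h-factors = proj₁ (proj₂ (universal ℕ∞-ab indicatorHom))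
    h∞∣a : mult P (fun h ∞) ∣ mult A a
    h∞∣a = mult-∣-of-constant-coordinates power a (fun h ∞) (λ n → h-factors n ∞)
    k : ℕ
    k = proj₁ (mult-eventually-constant h)
    hk≡h∞ : mult P (fun h (fin k)) ≡ mult P (fun h ∞)
    hk≡h∞ = lower (proj₂ (mult-eventually-constant h) k ≤-refl)
    b∣hk : mult A b ∣ mult P (fun h (fin k))
    b∣hk = subst (λ x → mult A x ∣ mult P (fun h (fin k)))
                 (trans (h-factors k (fin k)) (indicator-at k))
                 (div (π k) (fun h (fin k)))

proposition6p5 : ∀ (ℓ : Level) → ¬ CountablePower (TwoPoint.ab ℓ)
proposition6p5 ℓ = nonDividing⇒¬CountablePower (TwoPoint.ab ℓ) (lift false) (lift true) 2∤1
  where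
  2∤1 : ¬ (2 ∣ 1)
  2∤1 2∣1 with ∣⇒≤ 2∣1
  ... | s≤s ()
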